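{- Let $\Sigma$ be a finite filtration-ready set of formulas and $\mathcal{M}^f$ the filtration of the canonical model through $\Sigma$. Then: (D1) $R^f_{[i]}\subseteq R^f_\Box$ for all $i\in\mathsf{Agt}$; (D2) for every $R^f_\Box$-equivalence class $M$ and every function $f$ assigning to each $i\in\mathsf{Agt}$ an $R^f_{[i]}$-equivalence class $f(i)\subseteq M$, $\bigcap_{i\in\mathsf{Agt}}f(i)\neq\varnothing$; (D3*) $R^f_{\mathsf{Agt}}\subseteq\bigcap_{i\in\mathsf{Agt}}R^f_{[i]}$.
   Context: Fix a finite non-empty set of agents $\mathsf{Agt}$ and a countably infinite set $\mathsf{Prop}$. $\mathcal{L}_{\mathrm{DTDS}}$: $\varphi::=p\mid\neg\varphi\mid(\varphi\land\varphi)\mid\Box\varphi\mid[i]\varphi\mid[\mathsf{Agt}]\varphi\mid\mathsf{O}_i\varphi\mid\mathsf{X}\varphi\mid\mathsf{U}(\varphi,\varphi)$. $\mathsf{L}_{\mathrm{DTDS}}$ is the smallest set of formulas containing all instances (for all $i$) of: propositional tautologies; K,T,4,5 for $\Box,[i],[\mathsf{Agt}]$; K for $\mathsf{O}_i,\mathsf{X}$; $\Box\varphi\to[i]\varphi$; $\bigwedge_i\Diamond[i]\varphi_i\to\Diamond\bigwedge_i[i]\varphi_i$; $\bigwedge_i[i]\varphi_i\to[\mathsf{Agt}]\bigwedge_i\varphi_i$; $[\mathsf{Agt}]\mathsf{X}\varphi\to\mathsf{X}\Box\varphi$; $\Box\varphi\to\mathsf{O}_i\varphi$; $\mathsf{O}_i\varphi\to\neg\mathsf{O}_i\neg\varphi$;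 $\mathsf{O}_i\varphi\to\mathsf{O}_i[i]\varphi$; $\mathsf{O}_i\varphi\to\Box\mathsf{O}_i\varphi$; $\mathsf{X}\varphi\leftrightarrow\neg\mathsf{X}\neg\varphi$; $\mathsf{U}(\varphi,\psi)\leftrightarrow(\varphi\lor(\psi\land\mathsf{X}\mathsf{U}(\varphi,\psi)))$; closed under modus ponens, necessitation for $\Box,[\mathsf{Agt}],\mathsf{X},[i],\mathsf{O}_i$, and: from $\chi\to(\neg\varphi\land\mathsf{X}\chi)$ infer $\chi\to\neg\mathsf{U}(\varphi,\psi)$. Canonical model: $S^c$ = maximal $\mathsf{L}_{\mathrm{DTDS}}$-consistent sets; for $O\in\{\Box,[\mathsf{Agt}]\}\cup\{[i],\mathsf{O}_i\mid i\in\mathsf{Agt}\}$, $wR^c_Ov$ iff $\varphi\in v$ whenever $O\varphi\in w$; $w\to^cv$ iff $\varphi\in v$ whenever $\mathsf{X}\varphi\in w$. $\Sigma$ is filtration-ready if closed under subformulas; closed under $\dot\neg$ ($\dot\neg\neg\psi=\psi$, $\dot\neg\psi=\neg\psi$ otherwise); $\mathsf{U}(\alpha,\beta)\in\Sigma\Rightarrow\mathsf{X}\mathsf{U}(\alpha,\beta)\in\Sigma$; $\mathsf{O}_i\varphi\in\Sigma\Rightarrow[i]\varphi\in\Sigma$. Filtration $\mathcal{M}^f$: $\Sigma(w)=w\cap\Sigma$; $w\sim v$ iff $\Sigma(w)=\Sigma(v)$ and $\{\Sigma(x)\mid wR^c_\Box x\}=\{\Sigma(x)\mid vR^c_\Box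 x\}$; $|w|$ is the $\sim$-class of $w$ and $S^f$ the set of $\sim$-classes. For each operator $O$, $CR^e_OD$ iff there are $w\in C$, $v\in D$ with $wR^c_Ov$. $R^f_\Box=R^e_\Box$; $C\to^fD$ iff there are $w\in C,v\in D$ with $w\to^cv$; $R^f_{\mathsf{Agt}}$ and $R^f_{[i]}$ are the transitive closures of $R^e_{[\mathsf{Agt}]}$ and $R^e_{[i]}$; $R^f_{\mathsf{O}_i}=R^e_{\mathsf{O}_i}\circ R^f_{[i]}$ (composition: $x(R\circ R')y$ iff $xRz$, $zR'y$ for some $z$). -}

module Defs where

open import Level using (Level; 0ℓ) renaming (suc to lsuc)
open import Data.Nat using (ℕ; zero; suc)
open import Data.Fin using (Fin; zero; suc)
open import Data.Bool using (Bool; true; false; not; _∧_)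
open import Data.List using (List; []; _∷_)
open import Data.List.Membership.Propositional using (_∈_)
open import Data.List.Relation.Unary.All using (All)
open import Data.Product using (Σ; ∃; _×_; _,_)
open import Data.Sum using (_⊎_)
open import Relation.Binary.PropositionalEquality using (_≡_)
open import Relation.Nullary using (¬_)
open import Relation.Binary.Construct.Closure.Transitive using (Plus)

data Fm (n : ℕ) : Set where
  atom  : ℕ → Fm n
  neg   : Fm n → Fm n
  _∧̇_   : Fm n → Fm n → Fm n
  box   : Fm n → Fm n
  stit  : Fin n → Fm n → Fm n
  agt   : Fm n → Fm n
  obl   : Fin n → Fm n → Fm n
  nxt   : Fm n → Fm n
  until : Fm n → Fm n → Fm n

infixr 6 _∧̇_
module _ {n : ℕ} where
  infixr 4 _⇒_ _⇔_
  infixr 5 _∨̇_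

  _⇒_ : Fm n → Fm n → Fm n
  φ ⇒ ψ = neg (φ ∧̇ neg ψ)

  _∨̇_ : Fm n → Fm n → Fm n
  φ ∨̇ ψ = neg (neg φ ∧̇ neg ψ)

  _⇔_ : Fm n → Fm n → Fm n
  φ ⇔ ψ = (φ ⇒ ψ) ∧̇ (ψ ⇒ φ)

  ⊤̇ : Fm n
  ⊤̇ = neg (atom 0 ∧̇ neg (atom 0))

  data Op : Set where
    oBox oAgt oNxt : Op
    oStit oObl : Fin n → Op

  ⟦_⟧ : Op → Fm n → Fm n
  ⟦ oBox ⟧ φ = box φ
  ⟦ oAgt ⟧ φ = agt φ
  ⟦ oNxt ⟧ φ = nxt φ
  ⟦ oStit i ⟧ φ = stit i φ
  ⟦ oObl i ⟧ φ = obl i φ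

  data S5Op : Op → Set where
    s5Box  : S5Op oBox
    s5Agt  : S5Op oAgt
    s5Stit : ∀ i → S5Op (oStit i)

  dia : Op → Fm n → Fm n
  dia o φ = neg (⟦ o ⟧ (neg φ))

  -- propositional tautologies: true under every Boolean valuation that
  -- treats atoms and modal formulas as propositional atoms
  eval : (Fm n → Bool) → Fm n → Bool
  eval v (neg φ) = not (eval v φ)
  eval v (φ ∧̇ ψ) = eval v φ ∧ eval v ψ
  eval v φ = v φ

  Taut : Fm n → Set
  Taut φ = ∀ (v : Fm n → Bool) → eval v φ ≡ true

  conj : List (Fm n) → Fm n
  conj [] = ⊤̇
  conj (φ ∷ φs) = φ ∧̇ conj φs

⋀ : ∀ {n m} → (Fin (suc m) → Fm n) → Fm n
⋀ {m = zero} f = f zero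
⋀ {m = suc m} f = f zero ∧̇ ⋀ {m = m} (λ i → f (suc i))

data ⊢_ {k : ℕ} : Fm (suc k) → Set where
  taut   : ∀ {φ} → Taut φ → ⊢ φ
  axK    : ∀ o {φ ψ} → ⊢ (⟦ o ⟧ (φ ⇒ ψ) ⇒ (⟦ o ⟧ φ ⇒ ⟦ o ⟧ ψ))
  axT    : ∀ {o} → S5Op o → ∀ {φ} → ⊢ (⟦ o ⟧ φ ⇒ φ)
  ax4    : ∀ {o} → S5Op o → ∀ {φ} → ⊢ (⟦ o ⟧ φ ⇒ ⟦ o ⟧ (⟦ o ⟧ φ))
  ax5    : ∀ {o} → S5Op o → ∀ {φ} → ⊢ (neg (⟦ o ⟧ φ) ⇒ ⟦ o ⟧ (neg (⟦ o ⟧ φ)))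
  boxStit : ∀ i {φ} → ⊢ (box φ ⇒ stit i φ)
  indep  : ∀ (φs : Fin (suc k) → Fm (suc k)) →
           ⊢ (⋀ (λ i → dia oBox (stit i (φs i))) ⇒ dia oBox (⋀ (λ i → stit i (φs i))))
  stitAgt : ∀ (φs : Fin (suc k) → Fm (suc k)) →
           ⊢ (⋀ (λ i → stit i (φs i)) ⇒ agt (⋀ φs))
  agtNxt : ∀ {φ} → ⊢ (agt (nxt φ) ⇒ nxt (box φ))
  boxObl : ∀ i {φ} → ⊢ (box φ ⇒ obl i φ)
  oblD   : ∀ i {φ} → ⊢ (obl i φ ⇒ neg (obl i (neg φ)))
  oblStit : ∀ i {φ} → ⊢ (obl i φ ⇒ obl i (stit i φ))
  oblBox : ∀ i {φ} → ⊢ (obl i φ ⇒ box (obl i φ))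
  nxtFun : ∀ {φ} → ⊢ (nxt φ ⇔ neg (nxt (neg φ)))
  untilFix : ∀ {φ ψ} → ⊢ (until φ ψ ⇔ (φ ∨̇ (ψ ∧̇ nxt (until φ ψ))))
  mp     : ∀ {φ ψ} → ⊢ (φ ⇒ ψ) → ⊢ φ → ⊢ ψ
  nec    : ∀ o {φ} → ⊢ φ → ⊢ (⟦ o ⟧ φ)
  untilInd : ∀ {χ φ ψ} → ⊢ (χ ⇒ (neg φ ∧̇ nxt χ)) → ⊢ (χ ⇒ neg (until φ ψ))

module _ {k : ℕ} where
  private F = Fm (suc k)

  Consistent : (F → Set) → Set
  Consistent Γ = ¬ (Σ (List F) λ L → All Γ L × ⊢ neg (conj L))

  MCS : (F → Set) → Set
  MCS Γ = Consistent Γ × (∀ φ → Consistent (λ ψ → Γ ψ ⊎ ψ ≡ φ) → Γ φ)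

record State (k : ℕ) : Set₁ where
  field
    mem : Fm (suc k) → Set
    isMCS : MCS mem
open State public

module _ {k : ℕ} where
  private F = Fm (suc k)

  Rc : Op → State k → State k → Set
  Rc o w v = ∀ φ → mem w (⟦ o ⟧ φ) → mem v φ

  data _≺_ : F → F → Set where
    ≺neg   : ∀ {φ} → φ ≺ neg φ
    ≺∧ˡ    : ∀ {φ ψ} → φ ≺ (φ ∧̇ ψ)
    ≺∧ʳ    : ∀ {φ ψ} → ψ ≺ (φ ∧̇ ψ)
    ≺box   : ∀ {φ} → φ ≺ box φ
    ≺stit  : ∀ {i φ} → φ ≺ stit i φ
    ≺agt   : ∀ {φ} → φ ≺ agt φ
    ≺obl   : ∀ {i φ} → φ ≺ obl i φ
    ≺nxt   : ∀ {φ} → φ ≺ nxt φ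
    ≺untilˡ : ∀ {φ ψ} → φ ≺ until φ ψ
    ≺untilʳ : ∀ {φ ψ} → ψ ≺ until φ ψ

  ¬̇ : F → F
  ¬̇ (neg ψ) = ψ
  ¬̇ ψ = neg ψ

  record FiltrationReady (Σf : List F) : Set where
    field
      subClosed  : ∀ {φ ψ} → φ ∈ Σf → ψ ≺ φ → ψ ∈ Σf
      negClosed  : ∀ {φ} → φ ∈ Σf → ¬̇ φ ∈ Σf
      untilClosed : ∀ {α β} → until α β ∈ Σf → nxt (until α β) ∈ Σf
      oblClosed  : ∀ {i φ} → obl i φ ∈ Σf → stit i φ ∈ Σf

  -- S^f is the set of ∼-classes; a class is
  -- represented by any of its members, and all relations below are
  -- ∼-invariant, so relations between classes are relations between
  -- representatives.

  module Filtration (Σf : List F) where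

    SameΣ : State k → State k → Set
    SameΣ w v = ∀ φ → φ ∈ Σf → (mem w φ → mem v φ) × (mem v φ → mem w φ)

    BoxImg⊆ : State k → State k → Set₁
    BoxImg⊆ w v = ∀ x → Rc oBox w x → Σ (State k) λ y → Rc oBox v y × SameΣ x y

    _∼_ : State k → State k → Set₁
    w ∼ v = SameΣ w v × BoxImg⊆ w v × BoxImg⊆ v w

    Re : Op → State k → State k → Set₁
    Re o c d = Σ (State k) λ w → Σ (State k) λ v → c ∼ w × d ∼ v × Rc o w v

    Rf□ : State k → State k → Set₁
    Rf□ = Re oBox

    Rf→ : State k → State k → Set₁
    Rf→ = Re oNxt

    RfAgt : State k → State k → Set₁
    RfAgt = Plus (Re oAgt)

    Rf[_] : Fin (suc k) → State k → State k → Set₁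
    Rf[ i ] = Plus (Re (oStit i))

    RfO : Fin (suc k) → State k → State k → Set₁
    RfO i c d = Σ (State k) λ e → Re (oObl i) c e × Rf[ i ] e d

{-# OPTIONS --safe #-}
module Submission where

-- (D1) and (D3*) come from the canonical inclusions [Agt] ⊆ [i] ⊆ □; for [Agt] ⊆ [i]
-- apply the axiom ⋀ⱼ [j]φⱼ → [Agt] ⋀ⱼ φⱼ with φᵢ = φ and φⱼ = ⊤ for j ≠ i.  For (D1)
-- it remains to see that Rᵉ□ is already transitive: the second half of ∼ remembers the
-- Σ-types of the whole □-cluster of a state, so a □-step from one representative of a
-- class can be replayed from any other representative.
-- (D2) Represent the classes f(i) by states yᵢ in the □-cluster of m.  The independence
-- axiom makes ⋃ᵢ {φ | [i]φ ∈ yᵢ} consistent: a finite part of it is entailed by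
-- ⋀ᵢ [i]χᵢ with [i]χᵢ ∈ yᵢ, and m contains every ◇[i]χᵢ, hence ◇ ⋀ᵢ [i]χᵢ.  A
-- Lindenbaum extension of this set is a common [i]-successor of all the yᵢ.

open import Axiom.ExcludedMiddle using (ExcludedMiddle)
open import Level using (0ℓ) renaming (suc to lsuc)
open import Data.Bool using (Bool; true; false; _∧_)
open import Data.Bool.Properties using (∧-conicalˡ; ∧-conicalʳ) renaming (_≟_ to _≟ᵇ_)
open import Data.Empty using (⊥-elim)
open import Data.Fin using (Fin; zero; suc; _≟_)
open import Data.List using (List; []; _∷_; _++_; map; foldl; cartesianProductWith; allFin)
open import Data.List.Membership.Propositional using (_∈_)
open import Data.List.Membership.Propositional.Properties
  using (∈-map⁺; ∈-++⁺ˡ; ∈-++⁺ʳ; ∈-cartesianProductWith⁺; ∈-allFin)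
open import Data.List.Relation.Unary.All as All using (All; []; _∷_)
open import Data.List.Relation.Unary.All.Properties using (++⁺; ++⁻)
open import Data.List.Relation.Unary.Any using (here; there)
open import Data.Nat using (ℕ; zero; suc; _⊔_; _≤′_; ≤′-refl; ≤′-step)
open import Data.Nat.Properties using (m≤m⊔n; m≤n⊔m; ≤⇒≤′)
open import Data.Product using (Σ; ∃; _×_; _,_; proj₁; proj₂)
open import Data.Sum using (_⊎_; inj₁; inj₂; [_,_]′; map₁; map₂)
open import Data.Vec.Functional using (updateAt)
open import Data.Vec.Functional.Properties using (updateAt-updates; updateAt-minimal)
open import Function using (_∘_; _$_; id; const; case_of_; _⇔_; mk⇔; Equivalence)
open import Relation.Nullary using (¬_; yes; no)
open import Relation.Nullary.Decidable using (decidable-stable)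
open import Relation.Unary using (Pred; _∪_; _⊆_)
open import Relation.Binary.PropositionalEquality using (_≡_; refl; sym; subst; cong₂)
open import Relation.Binary.Construct.Closure.Transitive
  using (Plus; [_]; _∼⁺⟨_⟩_)

open import Defs hiding (_⇔_)

open Equivalence using (to; from)

module _ {n : ℕ} (v : Fm n → Bool) where

  -- The Set-valued counterpart of eval, so that propositional reasoning about formulas
  -- is carried out with Agda's own ¬ and ×.
  Holds : Fm n → Set
  Holds (neg φ) = ¬ Holds φ
  Holds (φ ∧̇ ψ) = Holds φ × Holds ψ
  Holds φ = v φ ≡ true

  holds⇔true : ∀ φ → Holds φ ⇔ (eval v φ ≡ true)
  holds⇔true (neg φ) with eval v φ | holds⇔true φ
  ... | true  | h = mk⇔ (λ ¬h → ⊥-elim (¬h (from h refl))) (λ ())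
  ... | false | h = mk⇔ (const refl) (λ _ hφ → case to h hφ of λ ())
  holds⇔true (φ ∧̇ ψ) = mk⇔
    (λ (a , b) → cong₂ _∧_ (to (holds⇔true φ) a) (to (holds⇔true ψ) b))
    (λ e → from (holds⇔true φ) (∧-conicalˡ _ _ e) , from (holds⇔true ψ) (∧-conicalʳ _ _ e))
  holds⇔true (atom _)    = mk⇔ id id
  holds⇔true (box _)     = mk⇔ id id
  holds⇔true (stit _ _)  = mk⇔ id id
  holds⇔true (agt _)     = mk⇔ id id
  holds⇔true (obl _ _)   = mk⇔ id id
  holds⇔true (nxt _)     = mk⇔ id id
  holds⇔true (until _ _) = mk⇔ id id

  holds-stable : ∀ φ → ¬ ¬ Holds φ → Holds φ
  holds-stable φ ¬¬h = from (holds⇔true φ)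
    (decidable-stable (eval v φ ≟ᵇ true) (λ ¬e → ¬¬h (¬e ∘ to (holds⇔true φ))))

  holds-mp : ∀ φ ψ → Holds (φ ⇒ ψ) → Holds φ → Holds ψ
  holds-mp φ ψ h a = holds-stable ψ (λ ¬b → h (a , ¬b))

  ⊤-holds : Holds ⊤̇
  ⊤-holds (a , ¬a) = ¬a a

  conj-holds : ∀ L → Holds (conj L) ⇔ All Holds L
  conj-holds []      = mk⇔ (const []) (const ⊤-holds)
  conj-holds (φ ∷ L) = mk⇔ (λ (h , hs) → h ∷ to (conj-holds L) hs)
                           (λ { (h ∷ hs) → h , from (conj-holds L) hs })

  ⋀-holds : ∀ {m} (f : Fin (suc m) → Fm n) → Holds (⋀ f) → ∀ i → Holds (f i)
  ⋀-holds {zero}  f h       zero    = h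
  ⋀-holds {suc m} f (h , _) zero    = h
  ⋀-holds {suc m} f (_ , h) (suc i) = ⋀-holds (f ∘ suc) h i

valid⇒taut : ∀ {n} {φ : Fm n} → (∀ v → Holds v φ) → Taut φ
valid⇒taut {φ = φ} h v = to (holds⇔true v φ) (h v)

⋀-closed : ∀ {n} (P : Fm n → Set) → (∀ {φ ψ} → P φ → P ψ → P (φ ∧̇ ψ)) →
           ∀ {m} (f : Fin (suc m) → Fm n) → (∀ i → P (f i)) → P (⋀ f)
⋀-closed P ∧-closed {zero}  f h = h zero
⋀-closed P ∧-closed {suc m} f h = ∧-closed (h zero) (⋀-closed P ∧-closed (f ∘ suc) (h ∘ suc))

module _ {n m : ℕ} where

  only : Fin m → Fm n → Fin m → Fm n
  only i φ = updateAt (const ⊤̇) i (const φ)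

  only-self : ∀ i {φ} → only i φ i ≡ φ
  only-self i = updateAt-updates i (const ⊤̇)

  only-elim : (P : Fin m → Fm n → Set) → ∀ {i φ} → P i φ → (∀ j → P j ⊤̇) →
              ∀ j → P j (only i φ j)
  only-elim P {i} p q j with j ≟ i
  ... | yes refl = subst (P j) (sym (only-self j)) p
  ... | no j≢i   = subst (P j) (sym (updateAt-minimal j i (const ⊤̇) j≢i)) (q j)

module _ {n : ℕ} where

  unaries : List (Fm n → Fm n)
  unaries = neg ∷ box ∷ agt ∷ nxt ∷ map stit (allFin n) ++ map obl (allFin n)

  binaries : List (Fm n → Fm n → Fm n)
  binaries = _∧̇_ ∷ until ∷ []

  private
    _⊛_ : ∀ {A B : Set} → List (A → B) → List A → List B
    _⊛_ = cartesianProductWith _$_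

  formulas : ℕ → List (Fm n)
  formulas zero    = []
  formulas (suc p) =
    atom p ∷ formulas p ++ unaries ⊛ formulas p ++ (binaries ⊛ formulas p) ⊛ formulas p

  formulas-mono : ∀ {p q φ} → p ≤′ q → φ ∈ formulas p → φ ∈ formulas q
  formulas-mono ≤′-refl      = id
  formulas-mono (≤′-step p≤q) = there ∘ ∈-++⁺ˡ ∘ formulas-mono p≤q

  private
    unary : ∀ {f φ} → f ∈ unaries → ∃ (λ p → φ ∈ formulas p) → ∃ λ p → f φ ∈ formulas p
    unary f∈ (p , φ∈) =
      suc p , there (∈-++⁺ʳ (formulas p) (∈-++⁺ˡ (∈-cartesianProductWith⁺ _$_ f∈ φ∈)))

    binary : ∀ {f φ ψ} → f ∈ binaries →
             ∃ (λ p → φ ∈ formulas p) → ∃ (λ q → ψ ∈ formulas q) → ∃ λ r → f φ ψ ∈ formulas r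
    binary f∈ (p , φ∈) (q , ψ∈) = suc (p ⊔ q) , there (∈-++⁺ʳ (formulas (p ⊔ q)) (∈-++⁺ʳ _
      (∈-cartesianProductWith⁺ _$_
        (∈-cartesianProductWith⁺ _$_ f∈ (formulas-mono (≤⇒≤′ (m≤m⊔n p q)) φ∈))
        (formulas-mono (≤⇒≤′ (m≤n⊔m p q)) ψ∈))))

  formulas-complete : ∀ φ → ∃ λ p → φ ∈ formulas p
  formulas-complete (atom p)    = suc p , here refl
  formulas-complete (neg φ)     = unary (here refl) (formulas-complete φ)
  formulas-complete (box φ)     = unary (there (here refl)) (formulas-complete φ)
  formulas-complete (agt φ)     = unary (there (there (here refl))) (formulas-complete φ)
  formulas-complete (nxt φ)     = unary (there (there (there (here refl)))) (formulas-complete φ)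
  formulas-complete (stit i φ)  = unary (there (there (there (there
    (∈-++⁺ˡ (∈-map⁺ stit (∈-allFin i))))))) (formulas-complete φ)
  formulas-complete (obl i φ)   = unary (there (there (there (there
    (∈-++⁺ʳ (map stit (allFin n)) (∈-map⁺ obl (∈-allFin i))))))) (formulas-complete φ)
  formulas-complete (φ ∧̇ ψ)     = binary (here refl) (formulas-complete φ) (formulas-complete ψ)
  formulas-complete (until φ ψ) =
    binary (there (here refl)) (formulas-complete φ) (formulas-complete ψ)

module _ {k : ℕ} where
  private
    F = Fm (suc k)

  ⊢-⊨ : ∀ {Ps : List F} {φ} → All ⊢_ Ps → (∀ v → All (Holds v) Ps → Holds v φ) → ⊢ φ
  ⊢-⊨ []       h = taut (valid⇒taut (λ v → h v []))
  ⊢-⊨ (d ∷ ds) h = mp (⊢-⊨ ds (λ v hs (a , ¬b) → ¬b (h v (a ∷ hs)))) d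

  ⊢⊤ : ⊢ ⊤̇ {suc k}
  ⊢⊤ = ⊢-⊨ [] (λ v _ → ⊤-holds v)

  ⊢-∧ : ∀ {φ ψ : F} → ⊢ φ → ⊢ ψ → ⊢ (φ ∧̇ ψ)
  ⊢-∧ dφ dψ = ⊢-⊨ (dφ ∷ dψ ∷ []) (λ { v (a ∷ b ∷ []) → a , b })

  inconsistent : ∀ {Γ : Pred F 0ℓ} {L Ps} → All Γ L → All ⊢_ Ps →
                 (∀ v → All (Holds v) Ps → ¬ All (Holds v) L) → ¬ Consistent Γ
  inconsistent {L = L} as ds h con =
    con (L , as , ⊢-⊨ ds (λ v hs → h v hs ∘ to (conj-holds v L)))

  ∪-split : ∀ {Γ : Pred F 0ℓ} {φ L} → All (Γ ∪ (_≡ φ)) L →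
            Σ (List F) λ L′ → All Γ L′ × (∀ v → Holds v φ → All (Holds v) L′ → All (Holds v) L)
  ∪-split [] = [] , [] , λ _ _ _ → []
  ∪-split (inj₁ g ∷ as) with ∪-split as
  ... | L′ , gs , h = _ ∷ L′ , g ∷ gs , λ { v a (b ∷ bs) → b ∷ h v a bs }
  ∪-split (inj₂ refl ∷ as) with ∪-split as
  ... | L′ , gs , h = L′ , gs , λ v a bs → a ∷ h v a bs

  module _ (Γ : State k) where
    private
      consistent = proj₁ (isMCS Γ)
      maximal = proj₂ (isMCS Γ)

    ∈-closed : ∀ {L Ps φ} → All (mem Γ) L → All ⊢_ Ps →
               (∀ v → All (Holds v) Ps → All (Holds v) L → Holds v φ) → mem Γ φ
    ∈-closed {φ = φ} as ds h = maximal φ λ (L₂ , bs , d) →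
      let L′ , cs , split = ∪-split bs in
      inconsistent (++⁺ cs as) (d ∷ ds) (λ { v (¬L₂ ∷ hs) hL′L →
        let hL′ , hL = ++⁻ L′ hL′L in
        ¬L₂ (from (conj-holds v L₂) (split v (h v hs hL) hL′)) }) consistent

    ⊢⇒∈ : ∀ {φ} → ⊢ φ → mem Γ φ
    ⊢⇒∈ d = ∈-closed [] (d ∷ []) (λ { v (h ∷ []) [] → h })

    ∈-mp : ∀ {φ ψ} → mem Γ (φ ⇒ ψ) → mem Γ φ → mem Γ ψ
    ∈-mp {φ} {ψ} i a =
      ∈-closed (i ∷ a ∷ []) [] (λ { v [] (hi ∷ ha ∷ []) → holds-mp v φ ψ hi ha })

    ∈-∧ : ∀ {φ ψ} → mem Γ φ → mem Γ ψ → mem Γ (φ ∧̇ ψ)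
    ∈-∧ a b = ∈-closed (a ∷ b ∷ []) [] (λ { v [] (ha ∷ hb ∷ []) → ha , hb })

    neg∈⇒∉ : ∀ {φ} → mem Γ (neg φ) → ¬ mem Γ φ
    neg∈⇒∉ ¬a a = inconsistent (a ∷ ¬a ∷ []) [] (λ { v [] (h ∷ ¬h ∷ []) → ¬h h }) consistent

    ∉⇒neg∈ : ∀ {φ} → ¬ mem Γ φ → mem Γ (neg φ)
    ∉⇒neg∈ {φ} ∉ = maximal (neg φ) λ (L , bs , d) →
      let L′ , cs , split = ∪-split bs in
      ∉ (∈-closed cs (d ∷ []) (λ { v (¬L ∷ []) hL′ →
        holds-stable v φ (λ ¬h → ¬L (from (conj-holds v L) (split v ¬h hL′))) }))

    ∈-stable : ∀ {φ} → ¬ ¬ mem Γ φ → mem Γ φ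
    ∈-stable {φ} ¬¬a = maximal φ λ (L , bs , d) →
      ¬¬a (λ a → consistent (L , All.map [ id , (λ { refl → a }) ]′ bs , d))

    ∈-K : ∀ o {φ ψ} → mem Γ (⟦ o ⟧ (φ ⇒ ψ)) → mem Γ (⟦ o ⟧ φ) → mem Γ (⟦ o ⟧ ψ)
    ∈-K o = ∈-mp ∘ ∈-mp (⊢⇒∈ (axK o))

    ∈-⟦⟧-∧ : ∀ o {φ ψ} → mem Γ (⟦ o ⟧ φ) → mem Γ (⟦ o ⟧ ψ) → mem Γ (⟦ o ⟧ (φ ∧̇ ψ))
    ∈-⟦⟧-∧ o a b = ∈-K o (∈-K o (⊢⇒∈ (nec o pair)) a) b
      where
      pair : ∀ {φ ψ} → ⊢ (φ ⇒ (ψ ⇒ (φ ∧̇ ψ)))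
      pair = ⊢-⊨ [] (λ v [] (a , ¬[b⇒ab]) → ¬[b⇒ab] (λ (b , ¬ab) → ¬ab (a , b)))

  module _ {o : Op {suc k}} (s5 : S5Op o) where

    Rc-refl : ∀ w → Rc o w w
    Rc-refl w φ a = ∈-mp w (⊢⇒∈ w (axT s5)) a

    Rc-trans : ∀ {w v u} → Rc o w v → Rc o v u → Rc o w u
    Rc-trans {w} r s φ a = s φ (r _ (∈-mp w (⊢⇒∈ w (ax4 s5)) a))

    Rc-eucl : ∀ {w v u} → Rc o w v → Rc o w u → Rc o v u
    Rc-eucl {w} {v} {u} r s φ a = ∈-stable u λ φ∉u →
      neg∈⇒∉ v (r _ (∈-mp w (⊢⇒∈ w (ax5 s5)) (∉⇒neg∈ w (φ∉u ∘ s φ)))) a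

  ◇∈ : ∀ {o w y φ} → Rc o w y → mem y φ → mem w (dia o φ)
  ◇∈ {w = w} {y} r a = ∉⇒neg∈ w (λ □¬a → neg∈⇒∉ y (r _ □¬a) a)

  stit⊆box : ∀ i {w v} → Rc (oStit i) w v → Rc oBox w v
  stit⊆box i {w} r φ a = r φ (∈-mp w (⊢⇒∈ w (boxStit i)) a)

  ∈-stit-only : ∀ (w : Fin (suc k) → State k) {i φ} → mem (w i) (stit i φ) →
                ∀ j → mem (w j) (stit j (only i φ j))
  ∈-stit-only w a =
    only-elim (λ j θ → mem (w j) (stit j θ)) a (λ j → ⊢⇒∈ (w j) (nec (oStit j) ⊢⊤))

  agt⊆stit : ∀ i {w v} → Rc oAgt w v → Rc (oStit i) w v
  agt⊆stit i {w} {v} r φ a = ∈-closed v (r _ ⋀∈w ∷ []) []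
    (λ { u [] (h ∷ []) → subst (Holds u) (only-self i) (⋀-holds u (only i φ) h i) })
    where
    ⋀∈w : mem w (agt (⋀ (only i φ)))
    ⋀∈w = ∈-mp w (⊢⇒∈ w (stitAgt (only i φ)))
            (⋀-closed (mem w) (∈-∧ w) _ (∈-stit-only (const w) a))

  -- Δ ⊕ φ adds φ exactly when this keeps Δ consistent; stating the condition as a
  -- proposition instead of deciding it keeps Lindenbaum's construction constructive.
  _⊕_ : Pred F 0ℓ → F → Pred F 0ℓ
  (Δ ⊕ φ) ψ = Δ ψ ⊎ (ψ ≡ φ × Consistent (Δ ∪ (_≡ φ)))

  Consistent-anti : ∀ {Δ Δ′ : Pred F 0ℓ} → Δ ⊆ Δ′ → Consistent Δ′ → Consistent Δ
  Consistent-anti Δ⊆Δ′ con (L , as , d) = con (L , All.map Δ⊆Δ′ as , d)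

  ⊕-consistent : ∀ {Δ φ} → Consistent Δ → Consistent (Δ ⊕ φ)
  ⊕-consistent {Δ} {φ} con (L , as , d) =
    con (L , All.map [ id , ⊥-elim ∘ ¬con ∘ proj₂ ]′ as , d)
    where
    ¬con : ¬ Consistent (Δ ∪ (_≡ φ))
    ¬con con′ = con′ (L , All.map (map₂ proj₁) as , d)

  foldl-⊕-⊇ : ∀ {Δ} L → Δ ⊆ foldl _⊕_ Δ L
  foldl-⊕-⊇ []      = id
  foldl-⊕-⊇ (φ ∷ L) = foldl-⊕-⊇ L ∘ inj₁

  foldl-⊕-consistent : ∀ {Δ} L → Consistent Δ → Consistent (foldl _⊕_ Δ L)
  foldl-⊕-consistent []      = id
  foldl-⊕-consistent (φ ∷ L) = foldl-⊕-consistent L ∘ ⊕-consistent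

  foldl-⊕-adds : ∀ {Δ U L φ} → φ ∈ L → foldl _⊕_ Δ L ⊆ U → Consistent (U ∪ (_≡ φ)) →
                 foldl _⊕_ Δ L φ
  foldl-⊕-adds {L = φ ∷ L} (here refl) ⊆U con =
    foldl-⊕-⊇ L (inj₂ (refl , Consistent-anti (map₁ (⊆U ∘ foldl-⊕-⊇ L ∘ inj₁)) con))
  foldl-⊕-adds {L = _ ∷ _} (there φ∈) ⊆U con = foldl-⊕-adds φ∈ ⊆U con

  module Lindenbaum (Γ : Pred F 0ℓ) (Γ-consistent : Consistent Γ) where

    stage : ℕ → Pred F 0ℓ
    stage zero    = Γ
    stage (suc p) = foldl _⊕_ (stage p) (formulas p)

    stage-mono : ∀ {p q} → p ≤′ q → stage p ⊆ stage q
    stage-mono ≤′-refl       = id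
    stage-mono (≤′-step {q} p≤q) = foldl-⊕-⊇ {stage q} (formulas q) ∘ stage-mono p≤q

    stage-consistent : ∀ p → Consistent (stage p)
    stage-consistent zero    = Γ-consistent
    stage-consistent (suc p) = foldl-⊕-consistent (formulas p) (stage-consistent p)

    limit : Pred F 0ℓ
    limit φ = ∃ λ p → stage p φ

    finite⊆stage : ∀ {L} → All limit L → ∃ λ p → All (stage p) L
    finite⊆stage []             = 0 , []
    finite⊆stage ((p , a) ∷ as) =
      let q , bs = finite⊆stage as in
      p ⊔ q , stage-mono (≤⇒≤′ (m≤m⊔n p q)) a ∷ All.map (stage-mono (≤⇒≤′ (m≤n⊔m p q))) bs

    limit-consistent : Consistent limit
    limit-consistent (L , as , d) =
      let p , bs = finite⊆stage as in stage-consistent p (L , bs , d)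

    limit-maximal : ∀ φ → Consistent (limit ∪ (_≡ φ)) → limit φ
    limit-maximal φ con =
      let p , φ∈ = formulas-complete φ in
      suc p , foldl-⊕-adds φ∈ (suc p ,_) con

  lindenbaum : ∀ {Γ} → Consistent Γ → Σ (State k) λ w → Γ ⊆ mem w
  lindenbaum {Γ} con = record { mem = limit ; isMCS = limit-consistent , limit-maximal } , (0 ,_)
    where open Lindenbaum Γ con

  module _ (y : Fin (suc k) → State k) where

    stit-union : Pred F 0ℓ
    stit-union φ = ∃ λ i → mem (y i) (stit i φ)

    gather : ∀ {L} → All stit-union L →
             Σ (Fin (suc k) → F) λ χ → (∀ i → mem (y i) (stit i (χ i))) ×
                                       (∀ v → (∀ i → Holds v (χ i)) → All (Holds v) L)
    gather [] = const ⊤̇ , (λ i → ⊢⇒∈ (y i) (nec (oStit i) ⊢⊤)) , λ _ _ → []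
    gather {φ ∷ _} ((j , a) ∷ as) =
      let χ , χ∈ , sound = gather as in
      (λ i → only j φ i ∧̇ χ i) ,
      (λ i → ∈-⟦⟧-∧ (y i) (oStit i) (∈-stit-only y a i) (χ∈ i)) ,
      λ v h → subst (Holds v) (only-self j) (proj₁ (h j)) ∷ sound v (proj₂ ∘ h)

    stit-union-consistent : ∀ m → (∀ i → Rc oBox m (y i)) → Consistent stit-union
    stit-union-consistent m r (L , as , d) = neg∈⇒∉ m ◇A∈m (⊢⇒∈ m (nec oBox ⊢¬A))
      where
      χ = proj₁ (gather as)
      χ∈ = proj₁ (proj₂ (gather as))
      sound = proj₂ (proj₂ (gather as))
      A = ⋀ (λ i → stit i (χ i))

      ◇A∈m : mem m (dia oBox A)
      ◇A∈m = ∈-mp m (⊢⇒∈ m (indep χ))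
        (⋀-closed (mem m) (∈-∧ m) _ (λ i → ◇∈ {w = m} {y i} (r i) (χ∈ i)))

      ⊢¬A : ⊢ neg A
      ⊢¬A = ⊢-⊨ (d ∷ ⋀-closed ⊢_ ⊢-∧ _ (λ i → axT (s5Stit i)) ∷ [])
        λ { v (¬L ∷ T ∷ []) hA → ¬L (from (conj-holds v L) (sound v λ i →
              holds-mp v (stit i (χ i)) (χ i) (⋀-holds v _ T i) (⋀-holds v _ hA i))) }

  independence : ∀ m (y : Fin (suc k) → State k) → (∀ i → Rc oBox m (y i)) →
                 Σ (State k) λ x → ∀ i → Rc (oStit i) (y i) x
  independence m y r =
    let x , ⊆x = lindenbaum (stit-union-consistent y m r) in x , λ i φ a → ⊆x (i , a)

module _ {k : ℕ} (Σf : List (Fm (suc k))) where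
  open Filtration Σf

  SameΣ-refl : ∀ w → SameΣ w w
  SameΣ-refl w φ _ = id , id

  SameΣ-sym : ∀ {w v} → SameΣ w v → SameΣ v w
  SameΣ-sym s φ φ∈ = proj₂ (s φ φ∈) , proj₁ (s φ φ∈)

  SameΣ-trans : ∀ {w v u} → SameΣ w v → SameΣ v u → SameΣ w u
  SameΣ-trans s t φ φ∈ = proj₁ (t φ φ∈) ∘ proj₁ (s φ φ∈) , proj₂ (s φ φ∈) ∘ proj₂ (t φ φ∈)

  BoxImg⊆-refl : ∀ w → BoxImg⊆ w w
  BoxImg⊆-refl w x r = x , r , SameΣ-refl x

  BoxImg⊆-trans : ∀ {w v u} → BoxImg⊆ w v → BoxImg⊆ v u → BoxImg⊆ w u
  BoxImg⊆-trans p q x r =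
    let y , r′ , s = p x r ; z , r″ , t = q y r′ in z , r″ , SameΣ-trans {x} {y} {z} s t

  R□⇒BoxImg⊆ : ∀ {w v} → Rc oBox w v → BoxImg⊆ w v
  R□⇒BoxImg⊆ {w} {v} r x r′ = x , Rc-eucl s5Box {w} {v} {x} r r′ , SameΣ-refl x

  R□⇒BoxImg⊇ : ∀ {w v} → Rc oBox w v → BoxImg⊆ v w
  R□⇒BoxImg⊇ {w} {v} r x r′ = x , Rc-trans s5Box {w} {v} {x} r r′ , SameΣ-refl x

  ∼-refl : ∀ w → w ∼ w
  ∼-refl w = SameΣ-refl w , BoxImg⊆-refl w , BoxImg⊆-refl w

  ∼-sym : ∀ {w v} → w ∼ v → v ∼ w
  ∼-sym {w} {v} (s , p , q) = SameΣ-sym {w} {v} s , q , p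

  ∼-trans : ∀ {w v u} → w ∼ v → v ∼ u → w ∼ u
  ∼-trans {w} {v} {u} (s , p , q) (s′ , p′ , q′) =
    SameΣ-trans {w} {v} {u} s s′ ,
    BoxImg⊆-trans {w} {v} {u} p p′ ,
    BoxImg⊆-trans {u} {v} {w} q′ q

  ∼-R□-transfer : ∀ {c w v} → c ∼ w → Rc oBox w v → Σ (State k) λ y → Rc oBox c y × v ∼ y
  ∼-R□-transfer {c} {w} {v} (_ , c⊆w , w⊆c) wRv =
    let y , cRy , sameΣ = w⊆c v wRv in
    y , cRy , sameΣ ,
    BoxImg⊆-trans {v} {w} {y} (R□⇒BoxImg⊇ {w} {v} wRv)
      (BoxImg⊆-trans {w} {c} {y} w⊆c (R□⇒BoxImg⊆ {c} {y} cRy)) ,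
    BoxImg⊆-trans {y} {c} {v} (R□⇒BoxImg⊇ {c} {y} cRy)
      (BoxImg⊆-trans {c} {w} {v} c⊆w (R□⇒BoxImg⊆ {w} {v} wRv))

  Re□⇒R□ : ∀ {c d} → Re oBox c d → Σ (State k) λ y → Rc oBox c y × d ∼ y
  Re□⇒R□ {c} {d} (w , v , c∼w , d∼v , wRv) =
    let y , cRy , v∼y = ∼-R□-transfer {c} {w} {v} c∼w wRv in
    y , cRy , ∼-trans {d} {v} {y} d∼v v∼y

  Re□-trans : ∀ {c d e} → Re oBox c d → Re oBox d e → Re oBox c e
  Re□-trans {c} {d} {e} cd de =
    let y , cRy , d∼y = Re□⇒R□ {c} {d} cd
        z , dRz , e∼z = Re□⇒R□ {d} {e} de
        u , yRu , z∼u = ∼-R□-transfer {y} {d} {z} (∼-sym {d} {y} d∼y) dRz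
    in c , u , ∼-refl c , ∼-trans {e} {z} {u} e∼z z∼u , Rc-trans s5Box {c} {y} {u} cRy yRu

  Re-refl : ∀ {o} → S5Op o → ∀ c → Re o c c
  Re-refl s5 c = c , c , ∼-refl c , ∼-refl c , Rc-refl s5 c

  Rf[i]⊆Rf□ : ∀ i {c d} → Rf[ i ] c d → Rf□ c d
  Rf[i]⊆Rf□ i [ w , v , c∼w , d∼v , r ] = w , v , c∼w , d∼v , stit⊆box i {w} {v} r
  Rf[i]⊆Rf□ i {c} {e} (_∼⁺⟨_⟩_ _ {d} cRd dRe) =
    Re□-trans {c} {d} {e} (Rf[i]⊆Rf□ i cRd) (Rf[i]⊆Rf□ i dRe)

  RfAgt⊆Rf[i] : ∀ i {c d} → RfAgt c d → Rf[ i ] c d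
  RfAgt⊆Rf[i] i [ w , v , c∼w , d∼v , r ] = [ w , v , c∼w , d∼v , agt⊆stit i {w} {v} r ]
  RfAgt⊆Rf[i] i (c ∼⁺⟨ cRd ⟩ dRe)        = c ∼⁺⟨ RfAgt⊆Rf[i] i cRd ⟩ RfAgt⊆Rf[i] i dRe

  Rf[i]-common-successor : ∀ m (g : Fin (suc k) → State k) →
    (∀ i d → Rf[ i ] (g i) d → Rf□ m d) → Σ (State k) λ e → ∀ i → Rf[ i ] (g i) e
  Rf[i]-common-successor m g g⊆M =
    let x , yRx = independence m (proj₁ ∘ rep) (proj₁ ∘ proj₂ ∘ rep) in
    x , λ i → [ proj₁ (rep i) , x , proj₂ (proj₂ (rep i)) , ∼-refl x , yRx i ]
    where
    rep : ∀ i → Σ (State k) λ y → Rc oBox m y × g i ∼ y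
    rep i = Re□⇒R□ {m} {g i} (g⊆M i (g i) [ Re-refl (s5Stit i) (g i) ])

proposition12 : ExcludedMiddle 0ℓ → ExcludedMiddle (lsuc 0ℓ) →
    (k : ℕ) (Σf : List (Fm (suc k))) → FiltrationReady Σf →
    let open Filtration Σf in
    -- (D1)
    (∀ (i : Fin (suc k)) (c d : State k) → Rf[ i ] c d → Rf□ c d)
    -- (D2): M = the R□-class of m, f(i) = the R[i]-class of g i
    × (∀ (m : State k) (g : Fin (suc k) → State k) →
         (∀ i (d : State k) → Rf[ i ] (g i) d → Rf□ m d) →
         Σ (State k) λ e → ∀ i → Rf[ i ] (g i) e)
    -- (D3*)
    × (∀ (c d : State k) → RfAgt c d → ∀ (i : Fin (suc k)) → Rf[ i ] c d)
proposition12 _ _ k Σf _ =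
  (λ i c d → Rf[i]⊆Rf□ Σf i) , Rf[i]-common-successor Σf , (λ c d cRd i → RfAgt⊆Rf[i] Σf i cRd)
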